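{- Let $G$ be a graph and let $G^+$ be the graph obtained from $G$ by clique substitution at every vertex. Then $\mathrm{cop}(G^+)\ge \mathrm{cop}(G)$.
   Context: All graphs are finite, simple and undirected; $N(v)$ is the set of neighbours of $v$. Clique substitution at a vertex $v$ replaces $v$ by a clique of size $|N(v)|$ together with a perfect matching between the vertices of this clique and the vertices of $N(v)$. Formally, $G^+$ has vertex set $\bigcup_{v\in V(G)}(\{v\}\times N(v))$, and $(v_1,u_1)$, $(v_2,u_2)$ are adjacent iff $v_1=v_2$, or ($v_1=u_2$ and $u_1=v_2$). The game of Cops and Robber on a connected graph: the cop player places $k\ge 1$ cops on vertices (not necessarily distinct), then the robber chooses a vertex; then, starting with the cops, the players alternate moves, where in the cops' move each cop either stays or moves to an adjacent vertex, and in the robber's move the robber either stays or moves to an adjacent vertex. The cops win if at some point a cop and the robber occupy the same vertex; both players have complete information. The cop number $\mathrm{cop}$ of a connected graph is the least $k$ such that $k$ cops have a winning strategy; for a disconnected graph it is the maximum cop number of its connected components. -}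

module Defs where

open import Data.Nat using (ℕ; _≤_)
open import Data.Fin using (Fin)
open import Data.Bool using (Bool; true)
open import Data.Product using (Σ; ∃; _×_; _,_)
open import Data.Sum using (_⊎_)
open import Relation.Nullary using (¬_)
open import Relation.Binary.PropositionalEquality using (_≡_; _≢_)
open import Relation.Binary.Construct.Closure.ReflexiveTransitive using (Star)

record Graph (n : ℕ) : Set where
  field
    adj    : Fin n → Fin n → Bool
    sym    : ∀ u v → adj u v ≡ adj v u
    irrefl : ∀ v → ¬ (adj v v ≡ true)

-- The game of
-- Cops and Robber and the cop number are defined for arenas, so that they
-- apply uniformly to G and to G⁺ (whose vertex set is a subtype).
record Arena : Set₁ where
  field
    V : Set
    E : V → V → Set

open Arena public

toArena : ∀ {n} → Graph n → Arena
toArena {n} G = record { V = Fin n ; E = λ u v → Graph.adj G u v ≡ true }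

PlusV : ∀ {n} → Graph n → Set
PlusV {n} G = Σ (Fin n × Fin n) (λ { (v , u) → Graph.adj G v u ≡ true })

PlusE : ∀ {n} (G : Graph n) → PlusV G → PlusV G → Set
PlusE G ((v₁ , u₁) , _) ((v₂ , u₂) , _) =
  (v₁ ≡ v₂ × u₁ ≢ u₂) ⊎ (v₁ ≡ u₂ × u₁ ≡ v₂)

plus : ∀ {n} → Graph n → Arena
plus G = record { V = PlusV G ; E = PlusE G }

module _ (A : Arena) where
  private
    Vx = V A
    Ex = E A

  Cops : ℕ → Set
  Cops k = Fin k → Vx

  CopMove : ∀ {k} → Cops k → Cops k → Set
  CopMove c c' = ∀ i → c' i ≡ c i ⊎ Ex (c i) (c' i)

  Caught : ∀ {k} → Cops k → Vx → Set
  Caught c r = ∃ λ i → c i ≡ r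

  data CopsWin {k : ℕ} (c : Cops k) (r : Vx) : Set where
    caught : Caught c r → CopsWin c r
    move   : (c' : Cops k) → CopMove c c' →
             (Caught c' r ⊎ (∀ r' → (r' ≡ r ⊎ Ex r r') → CopsWin c' r')) →
             CopsWin c r

  Reach : Vx → Vx → Set
  Reach = Star Ex

  CopsWinComponent : ℕ → Vx → Set
  CopsWinComponent k v =
    ∃ λ (c : Cops k) → (∀ i → Reach v (c i)) ×
                       (∀ r → Reach v r → CopsWin c r)

  -- cop(A) ≤ k : k cops win on every connected component
  -- (cop number of a disconnected graph = max over its components).
  CopWinnable : ℕ → Set
  CopWinnable k = ∀ v → CopsWinComponent k v

  IsCopNumber : ℕ → Set
  IsCopNumber n =
    1 ≤ n × CopWinnable n × (∀ m → 1 ≤ m → CopWinnable m → n ≤ m)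

-- The vertices of G⁺ are the darts (v , u) of G, and projecting a dart to its
-- tail v maps G⁺ onto G.  Two consecutive moves in G⁺ project to at most one
-- move in G (a clique step keeps the tail, a matching step moves it to the
-- head, and two matching steps cancel), while a robber move r → r' in G is
-- played in G⁺ as the clique step to (r , r') followed by the matching step to
-- (r' , r).  So cops on G can shadow a winning strategy for G⁺: they stand on
-- the tails of the G⁺-cops one G⁺-move behind, and whenever the G⁺-cops catch
-- the robber, a G-cop is at or next to the robber in G.
module Submission where

open import Defs
open import Data.Nat using (ℕ; zero; suc; _≤_; s≤s; z≤n)
open import Data.Fin using (Fin; zero; _≟_)
open import Data.Fin.Properties using (any?)
open import Data.Bool using (true)
open import Data.Bool.Properties using () renaming (_≟_ to _≟ᵇ_)
open import Data.Product using (∃; ∃₂; _×_; _,_; proj₁; proj₂)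
open import Data.Sum using (_⊎_; inj₁; inj₂)
open import Data.Empty using (⊥-elim)
open import Function using (_∘_)
open import Relation.Nullary using (¬_; yes; no)
open import Relation.Binary.PropositionalEquality
open import Relation.Binary.Construct.Closure.ReflexiveTransitive
  using (Star; ε; _◅_; return; kleisliStar)

module _ (A : Arena) where

  Step : V A → V A → Set
  Step x y = y ≡ x ⊎ E A x y

  step⇒reach : ∀ {x y} → Step x y → Reach A x y
  step⇒reach (inj₁ refl) = ε
  step⇒reach (inj₂ e)    = return e

  capture-next : ∀ {k} (c : Cops A k) {r} (i : Fin k) → Step (c i) r → CopsWin A c r
  capture-next {k} c {r} i (inj₁ refl) = caught (i , refl)
  capture-next {k} c {r} i (inj₂ e)    = move c′ c→c′ (inj₁ (i , c′-i))
    where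
      c′ : Cops A k
      c′ j with j ≟ i
      ... | yes _ = r
      ... | no  _ = c j

      c→c′ : CopMove A c c′
      c→c′ j with j ≟ i
      ... | yes refl = inj₂ e
      ... | no  _    = inj₁ refl

      c′-i : c′ i ≡ r
      c′-i with i ≟ i
      ... | yes _   = refl
      ... | no  i≢i = ⊥-elim (i≢i refl)

  isolated-CopsWinComponent : ∀ k {v} → (∀ w → ¬ E A v w) → CopsWinComponent A (suc k) v
  isolated-CopsWinComponent k {v} isolated = (λ _ → v) , (λ _ → ε) , win
    where
      win : ∀ r → Reach A v r → CopsWin A (λ _ → v) r
      win r ε                 = caught (zero , refl)
      win r (_◅_ {j = w} e _) = ⊥-elim (isolated w e)

module _ {n : ℕ} (G : Graph n) where

  open Graph G using (adj)

  private
    P = plus G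
    A = toArena G

  tail head : PlusV G → Fin n
  tail ((v , _) , _) = v
  head ((_ , u) , _) = u

  tail-adj-head : ∀ x → adj (tail x) (head x) ≡ true
  tail-adj-head (_ , e) = e

  adj-sym : ∀ {u v} → adj u v ≡ true → adj v u ≡ true
  adj-sym {u} {v} e = trans (Graph.sym G v u) e

  Reverses : PlusV G → PlusV G → Set
  Reverses x y = tail y ≡ head x × head y ≡ tail x

  step-tail : ∀ {x y} → Step P x y → tail y ≡ tail x ⊎ Reverses x y
  step-tail (inj₁ refl)                   = inj₁ refl
  step-tail (inj₂ (inj₁ (v₁≡v₂ , _)))     = inj₁ (sym v₁≡v₂)
  step-tail (inj₂ (inj₂ (v₁≡u₂ , u₁≡v₂))) = inj₂ (sym u₁≡v₂ , sym v₁≡u₂)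

  step-projects : ∀ {x y} → Step P x y → Step A (tail x) (tail y)
  step-projects {x} s with step-tail s
  ... | inj₁ ty≡tx       = inj₁ ty≡tx
  ... | inj₂ (ty≡hx , _) =
    inj₂ (subst (λ t → adj (tail x) t ≡ true) (sym ty≡hx) (tail-adj-head x))

  two-steps-project : ∀ {x y z} → Step P x y → Step P y z → Step A (tail x) (tail z)
  two-steps-project {x} {y} s t with step-tail s | step-tail t
  ... | inj₁ ty≡tx       | inj₁ tz≡ty       = inj₁ (trans tz≡ty ty≡tx)
  ... | inj₁ ty≡tx       | inj₂ (tz≡hy , _) =
    inj₂ (subst₂ (λ a b → adj a b ≡ true) ty≡tx (sym tz≡hy) (tail-adj-head y))
  ... | inj₂ (ty≡hx , _) | inj₁ tz≡ty       =
    inj₂ (subst (λ t → adj (tail x) t ≡ true) (sym (trans tz≡ty ty≡hx)) (tail-adj-head x))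
  ... | inj₂ (_ , hy≡tx) | inj₂ (tz≡hy , _) = inj₁ (trans tz≡hy hy≡tx)

  reach-projects : ∀ {x y} → Reach P x y → Reach A (tail x) (tail y)
  reach-projects = kleisliStar tail (λ {x} {y} e → step⇒reach A (step-projects {x} {y} (inj₂ e)))

  reach-lifts : ∀ {v u} (e : adj v u ≡ true) {r} → Reach A v r →
                ∃ λ x → tail x ≡ r × Reach P ((v , u) , e) x
  reach-lifts e ε = _ , refl , ε
  reach-lifts {v} {u} e (_◅_ {j = w} a w⇝r) with reach-lifts (adj-sym a) w⇝r | u ≟ w
  ... | x , tx≡r , path | yes refl = x , tx≡r , inj₂ (refl , refl) ◅ path
  ... | x , tx≡r , path | no u≢w   =
    x , tx≡r , _◅_ {j = (v , w) , a} (inj₁ (refl , u≢w)) (inj₂ (refl , refl) ◅ path)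

  DartNear : PlusV G → Fin n → Set
  DartNear x r = Step A (tail x) r × Step A (head x) r

  step-into-dart : ∀ {x y r} → Step P x y → DartNear y r → Step A (tail x) r
  step-into-dart {r = r} s near with step-tail s
  ... | inj₁ ty≡tx       = subst (λ t → Step A t r) ty≡tx (proj₁ near)
  ... | inj₂ (_ , hy≡tx) = subst (λ t → Step A t r) hy≡tx (proj₂ near)

  lift-robber-step : ∀ q {r′} → Step A (tail q) r′ →
    ∃₂ λ q₁ q′ → Step P q q₁ × Step P q₁ q′ × DartNear q₁ (tail q′) × tail q′ ≡ r′
  lift-robber-step q@((r , p) , e) (inj₁ refl) =
    q , q , inj₁ refl , inj₁ refl , (inj₁ refl , inj₂ (adj-sym e)) , refl
  lift-robber-step q@((r , p) , e) {r′} (inj₂ a) with p ≟ r′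
  ... | yes refl = q , q′ , inj₁ refl , inj₂ (inj₂ (refl , refl)) , (inj₂ a , inj₁ refl) , refl
    where q′ = (r′ , r) , adj-sym a
  ... | no p≢r′  = q₁ , q′ , inj₂ (inj₁ (refl , p≢r′)) , inj₂ (inj₂ (refl , refl))
                 , (inj₂ a , inj₁ refl) , refl
    where q₁ = (r , r′) , a
          q′ = (r′ , r) , adj-sym a

  -- shadow: the G⁺-cops have just moved c₀ → c, the G-cops stand on tail ∘ c₀.
  -- shadow-mid-round: the G⁺-robber is halfway through a G-move, at the
  -- intermediate dart q, with the G⁺-cops to move; the G-robber has completed it.
  mutual
    shadow : ∀ {k} {c₀ c : Cops P k} {q} → CopsWin P c q → CopMove P c₀ c →
             CopsWin A (tail ∘ c₀) (tail q)
    shadow {c = c} (caught (i , c-i)) c₀→c =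
      move (tail ∘ c) (step-projects ∘ c₀→c) (inj₁ (i , cong tail c-i))
    shadow {c = c} (move c₁ c→c₁ (inj₁ (i , c₁-i))) c₀→c =
      move (tail ∘ c₁) (λ j → two-steps-project (c₀→c j) (c→c₁ j)) (inj₁ (i , cong tail c₁-i))
    shadow {q = q} (move c₁ c→c₁ (inj₂ next)) c₀→c =
      move (tail ∘ c₁) (λ j → two-steps-project (c₀→c j) (c→c₁ j)) (inj₂ robber-moves)
      where
        robber-moves : ∀ r′ → Step A (tail q) r′ → CopsWin A (tail ∘ c₁) r′
        robber-moves r′ s with lift-robber-step q s
        ... | q₁ , _ , s₁ , s₂ , near , refl = shadow-mid-round (next q₁ s₁) s₂ near

    shadow-mid-round : ∀ {k} {c : Cops P k} {q q′} → CopsWin P c q → Step P q q′ →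
                       DartNear q (tail q′) → CopsWin A (tail ∘ c) (tail q′)
    shadow-mid-round {c = c} (caught (i , c-i)) _ near =
      capture-next A (tail ∘ c) i (step-into-dart (inj₁ (sym c-i)) near)
    shadow-mid-round {c = c} (move c₁ c→c₁ (inj₁ (i , c₁-i))) _ near =
      capture-next A (tail ∘ c) i
        (step-into-dart (c→c₁ i) (subst (λ y → DartNear y _) (sym c₁-i) near))
    shadow-mid-round (move c₁ c→c₁ (inj₂ next)) s _ = shadow (next _ s) c→c₁

  cop-winnable-from-plus : ∀ k → CopWinnable P (suc k) → CopWinnable A (suc k)
  cop-winnable-from-plus k P-win v with any? (λ u → adj v u ≟ᵇ true)
  ... | no isolated = isolated-CopsWinComponent A k (λ w e → isolated (w , e))
  ... | yes (u , e) with P-win ((v , u) , e)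
  ... | c , c-reach , c-win = tail ∘ c , reach-projects ∘ c-reach , win
    where
      win : ∀ r → Reach A v r → CopsWin A (tail ∘ c) r
      win r v⇝r with reach-lifts e v⇝r
      ... | x , refl , path = shadow (c-win x path) (λ _ → inj₁ refl)

lemma7 : ∀ {n} (G : Graph n) (a b : ℕ) →
    IsCopNumber (toArena G) a → IsCopNumber (plus G) b → a ≤ b
lemma7 G a zero    _                 (() , _)
lemma7 G a (suc k) (_ , _ , a-least) (_ , b-wins , _) =
  a-least (suc k) (s≤s z≤n) (cop-winnable-from-plus G k b-wins)
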